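{- Let $\mathcal{A}_2$ be OPTIMISTIC with $k=2$ and sampling threshold $t$ ($2 < t \le n-2$) on $n$ items with distinct values $v_1 > \dots > v_n$. Let $P_1$ be the set of permutations on which $\mathcal{A}_2$ accepts $v_1$ and $P_1' = \{\pi \in P_1 \mid \mathrm{pos}_\pi(v_2) < t \implies \mathcal{A}_2 \text{ accepts } v_1 \text{ as its first accepted item}\}$. If $\pi$ is drawn uniformly at random from all $n!$ permutations, then \[ \delta := \Pr[\pi \in P_1 \setminus P_1'] = \frac{t-1}{n}\cdot\frac{t-2}{n-1}\sum_{i=t}^{n-1}\frac{n-i}{(i-2)(i-1)}. \]
   Context: $\mathrm{pos}_\pi(v)$ denotes the position of item $v$ in the permutation $\pi$. OPTIMISTIC with $k=2$ and threshold $t$: reject the first $t-1$ items; let $s_1 > s_2$ be the two best among them; accept as first item the first item (at position $\ge t$) better than $s_2$; after that, accept as second item the first subsequent item better than $s_1$; decisions are immediate and irrevocable. -}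

module Defs where

open import Data.Bool using (Bool; true; false; _∧_; _∨_; not; if_then_else_)
open import Data.Nat using (ℕ; zero; suc; _+_; _*_; _∸_; _<ᵇ_; _≡ᵇ_; _!)
open import Data.Nat.Properties using (_≟_)
open import Data.List using (List; []; _∷_; length; map; concatMap; upTo; take; drop; filter; foldr; filterᵇ)
open import Data.List.Relation.Unary.Unique.DecPropositional _≟_ using (unique?)
open import Data.Maybe using (Maybe; just; nothing)
open import Data.Product using (_×_; _,_)
open import Data.Integer using (+_)
open import Data.Rational using (ℚ; _/_; 0ℚ) renaming (_+_ to _+ℚ_)

-- Items are identified with their rank: item j (0 ≤ j < n) has value v_{j+1},
-- so a smaller number means a better item (item 0 = v_1, item 1 = v_2).
-- A permutation π is the list of items in arrival order (π[p] = item at position p+1).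

allLists : ℕ → ℕ → List (List ℕ)
allLists n zero    = [] ∷ []
allLists n (suc k) = concatMap (λ x → map (x ∷_) (allLists n k)) (upTo n)

permutations : ℕ → List (List ℕ)
permutations n = filter unique? (allLists n n)

-- 1-indexed position of item v in π
pos : ℕ → List ℕ → ℕ
pos v []       = 1
pos v (x ∷ xs) = if v ≡ᵇ x then 1 else suc (pos v xs)

-- two best (smallest-rank) items of a list; `bound` is a sentinel worse than every item
best2 : ℕ → List ℕ → ℕ × ℕ
best2 bound = foldr ins (bound , bound)
  where
  ins : ℕ → ℕ × ℕ → ℕ × ℕ
  ins x (a , b) = if x <ᵇ a then (x , a) else (if x <ᵇ b then (a , x) else (a , b))

firstBetter : ℕ → List ℕ → Maybe (ℕ × List ℕ)
firstBetter s []       = nothing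
firstBetter s (x ∷ xs) = if x <ᵇ s then just (x , xs) else firstBetter s xs

optimistic2 : ℕ → ℕ → List ℕ → List ℕ
optimistic2 n t π with best2 n (take (t ∸ 1) π)
... | (s₁ , s₂) with firstBetter s₂ (drop (t ∸ 1) π)
...   | nothing         = []
...   | just (a , rest) with firstBetter s₁ rest
...     | nothing        = a ∷ []
...     | just (b , _)   = a ∷ b ∷ []

elemᵇ : ℕ → List ℕ → Bool
elemᵇ v []       = false
elemᵇ v (x ∷ xs) = (v ≡ᵇ x) ∨ elemᵇ v xs

firstAcceptedIs : ℕ → List ℕ → Bool
firstAcceptedIs v []      = false
firstAcceptedIs v (x ∷ _) = v ≡ᵇ x

inP₁ : ℕ → ℕ → List ℕ → Bool
inP₁ n t π = elemᵇ 0 (optimistic2 n t π)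

inP₁' : ℕ → ℕ → List ℕ → Bool
inP₁' n t π = inP₁ n t π ∧ (not (pos 1 π <ᵇ t) ∨ firstAcceptedIs 0 (optimistic2 n t π))

-- a / b as a rational, with the convention a / 0 = 0 (only used with b ≠ 0)
frac : ℕ → ℕ → ℚ
frac a zero    = 0ℚ
frac a (suc b) = (+ a) / suc b

sumℚ : List ℚ → ℚ
sumℚ = foldr _+ℚ_ 0ℚ

range : ℕ → ℕ → List ℕ
range t n = map (λ j → t + j) (upTo (n ∸ t))

probPerm : ℕ → (List ℕ → Bool) → ℚ
probPerm n E = frac (length (filterᵇ E (permutations n))) (n !)

-- Count arrival orders as arrangements, placing v₁ and v₂ (items 0 and 1) into an arrangement σ of
-- the other items. The event P₁ ∖ P₁′ happens exactly when v₂ is among the t − 1 sampled positions,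
-- v₁ arrives at position t + j, and one of the j items between the sample and v₁ beats the other t − 2
-- sampled items; that is, the minimum of the first t − 2 + j entries of σ lies among the last j of them,
-- which holds for a fraction j / (t − 2 + j) of all σ (insert the smallest item into an arrangement of
-- the others and induct). Hence δ = (t − 1) / (n (n − 1)) · Σ_{j=0}^{n−t} j / (A + j) with A = t − 2,
-- and Σ_{j≤e} j / (A + j) = A Σ_{j<e} (e − j) / ((A + j)(A + j + 1)) by induction on e, via the
-- telescoping sum Σ_{j<e} 1 / ((A + j)(A + j + 1)) = e / (A (A + e)).

module Submission where

open import Defs
open import Data.Bool using (Bool; true; false; _∧_; _∨_; not; if_then_else_; T)
open import Algebra.Bundles using (CommutativeMonoid)
import Algebra.Properties.CommutativeSemigroup as CommutativeSemigroupProperties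
open import Data.Bool.Properties using (∧-zeroʳ; ∨-zeroʳ; ∧-commutativeMonoid)
open import Data.Empty using (⊥-elim)
open import Data.List using (List; []; _∷_; length; map; foldr; concat; concatMap; upTo; applyUpTo; take; drop; filter; filterᵇ; _++_)
open import Data.List.Properties using (map-cong; map-cong-local; length-applyUpTo; map-upTo; map-∘)
open import Data.List.Relation.Unary.All using (All; []; _∷_)
import Data.List.Relation.Unary.All as All
open import Data.List.Relation.Unary.All.Properties using (take⁺; drop⁺; applyUpTo⁺₁)
open import Data.Maybe using (just; nothing)
open import Data.Nat using (ℕ; zero; suc; _+_; _*_; _∸_; _⊓_; _<ᵇ_; _≡ᵇ_; _!; _≤_; _<_; z≤n; s≤s; z<s; s<s; NonZero)
open import Data.Nat.ListAction using (sum)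
open import Data.Nat.Properties
open import Data.List.Relation.Unary.Unique.DecPropositional _≟_ using (unique?)
open import Data.Nat.Tactic.RingSolver using (solve-∀)
open import Data.Rational using (ℚ; 0ℚ; toℚᵘ) renaming (_+_ to _+ℚ_; _*_ to _*ℚ_)
import Data.Rational.Properties as ℚ
open import Data.Rational.Unnormalised as ℚᵘ using (mkℚᵘ; *≡*; _≃_)
import Data.Rational.Unnormalised.Properties as ℚᵘ
import Data.Integer as ℤ
import Data.Integer.Properties as ℤ
open import Data.Product using (_×_; _,_; Σ; ∃; proj₁; proj₂)
open import Data.Sum using (inj₁; inj₂)
open import Data.Unit using (tt)
open import Function using (_∘_)
open import Relation.Nullary using (does; ¬?)
open import Relation.Binary.PropositionalEquality

open CommutativeSemigroupProperties +-commutativeSemigroup using () renaming (interchange to +-interchange)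
open CommutativeSemigroupProperties (CommutativeMonoid.commutativeSemigroup ∧-commutativeMonoid)
  using () renaming (interchange to ∧-interchange)
open CommutativeSemigroupProperties (CommutativeMonoid.commutativeSemigroup ℚ.+-0-commutativeMonoid)
  using () renaming (interchange to +ℚ-interchange)

≡ᵇ-true⇒≡ : ∀ {x y} → (x ≡ᵇ y) ≡ true → x ≡ y
≡ᵇ-true⇒≡ {x} {y} e = ≡ᵇ⇒≡ x y (subst T (sym e) tt)

≡ᵇ-refl : ∀ x → (x ≡ᵇ x) ≡ true
≡ᵇ-refl zero    = refl
≡ᵇ-refl (suc x) = ≡ᵇ-refl x

≡ᵇ-sym : ∀ x y → (x ≡ᵇ y) ≡ (y ≡ᵇ x)
≡ᵇ-sym zero    zero    = refl
≡ᵇ-sym zero    (suc y) = refl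
≡ᵇ-sym (suc x) zero    = refl
≡ᵇ-sym (suc x) (suc y) = ≡ᵇ-sym x y

<ᵇ-true⇒< : ∀ {x y} → (x <ᵇ y) ≡ true → x < y
<ᵇ-true⇒< {x} {y} e = <ᵇ⇒< x y (subst T (sym e) tt)

<⇒<ᵇ-true : ∀ {x y} → x < y → (x <ᵇ y) ≡ true
<⇒<ᵇ-true {x} {y} lt with x <ᵇ y | <⇒<ᵇ lt
... | true | _ = refl

≥⇒<ᵇ-false : ∀ {x y} → y ≤ x → (x <ᵇ y) ≡ false
≥⇒<ᵇ-false {x} {y} le with x <ᵇ y in eq
... | false = refl
... | true  = ⊥-elim (<⇒≱ (<ᵇ-true⇒< eq) le)

∧-true₁ : ∀ {a b} → a ∧ b ≡ true → a ≡ true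
∧-true₁ {true} _ = refl

∧-true₂ : ∀ {a b} → a ∧ b ≡ true → b ≡ true
∧-true₂ {true} e = e

-- Counting arrangements

indicator : Bool → ℕ
indicator true  = 1
indicator false = 0

_∉ᵇ_ : ℕ → List ℕ → Bool
x ∉ᵇ []       = true
x ∉ᵇ (y ∷ ys) = not (x ≡ᵇ y) ∧ x ∉ᵇ ys

uniqueᵇ : List ℕ → Bool
uniqueᵇ []       = true
uniqueᵇ (x ∷ xs) = x ∉ᵇ xs ∧ uniqueᵇ xs

disjointᵇ : List ℕ → List ℕ → Bool
disjointᵇ []       F = true
disjointᵇ (y ∷ ys) F = y ∉ᵇ F ∧ disjointᵇ ys F

select : (ℕ → Bool) → List ℕ → List ℕ
select q []       = []
select q (y ∷ ys) = if q y then y ∷ select q ys else select q ys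

remove : ℕ → List ℕ → List ℕ
remove x = select (λ y → not (y ≡ᵇ x))

count : (List ℕ → Bool) → List (List ℕ) → ℕ
count Q []       = 0
count Q (y ∷ ys) = indicator (Q y) + count Q ys

-- For duplicate-free S, #arr k S P counts the duplicate-free lists of length k over S satisfying P.
#arr : ℕ → List ℕ → (List ℕ → Bool) → ℕ
#arr zero    S P = indicator (P [])
#arr (suc k) S P = sum (map (λ x → #arr k (remove x S) (λ ys → P (x ∷ ys))) S)

unique?≡uniqueᵇ : ∀ ys → does (unique? ys) ≡ uniqueᵇ ys
unique?≡uniqueᵇ []       = refl
unique?≡uniqueᵇ (x ∷ ys) = cong₂ _∧_ (all-distinct x ys) (unique?≡uniqueᵇ ys)
  where
  all-distinct : ∀ x ys → does (All.all? (λ y → ¬? (x ≟ y)) ys) ≡ x ∉ᵇ ys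
  all-distinct x []       = refl
  all-distinct x (y ∷ ys) = cong (not (x ≡ᵇ y) ∧_) (all-distinct x ys)

length-filterᵇ-unique : ∀ E L → length (filterᵇ E (filter unique? L)) ≡ count (λ ys → uniqueᵇ ys ∧ E ys) L
length-filterᵇ-unique E [] = refl
length-filterᵇ-unique E (y ∷ L) with does (unique? y) | unique?≡uniqueᵇ y
... | false | eq rewrite sym eq = length-filterᵇ-unique E L
... | true  | eq rewrite sym eq with E y
...   | true  = cong suc (length-filterᵇ-unique E L)
...   | false = length-filterᵇ-unique E L

count-cong : ∀ {Q Q′} → (∀ ys → Q ys ≡ Q′ ys) → ∀ L → count Q L ≡ count Q′ L
count-cong e []      = refl
count-cong e (y ∷ L) = cong₂ _+_ (cong indicator (e y)) (count-cong e L)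

count-++ : ∀ Q A B → count Q (A ++ B) ≡ count Q A + count Q B
count-++ Q []      B = refl
count-++ Q (y ∷ A) B = trans (cong (indicator (Q y) +_) (count-++ Q A B)) (sym (+-assoc (indicator (Q y)) _ _))

count-map : ∀ Q (g : List ℕ → List ℕ) A → count Q (map g A) ≡ count (Q ∘ g) A
count-map Q g []      = refl
count-map Q g (y ∷ A) = cong (indicator (Q (g y)) +_) (count-map Q g A)

count-concatMap : ∀ Q (f : ℕ → List (List ℕ)) L → count Q (concatMap f L) ≡ sum (map (count Q ∘ f) L)
count-concatMap Q f []      = refl
count-concatMap Q f (x ∷ L) = trans (count-++ Q (f x) (concat (map f L))) (cong (count Q (f x) +_) (count-concatMap Q f L))

count-false : ∀ Q → (∀ ys → Q ys ≡ false) → ∀ L → count Q L ≡ 0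
count-false Q e []      = refl
count-false Q e (y ∷ L) rewrite e y = count-false Q e L

sum-select : ∀ q (g : ℕ → ℕ) L → sum (map g (select q L)) ≡ sum (map (λ x → if q x then g x else 0) L)
sum-select q g []      = refl
sum-select q g (y ∷ L) with q y
... | true  = cong (g y +_) (sum-select q g L)
... | false = sum-select q g L

select-select : ∀ p q L → select p (select q L) ≡ select (λ y → p y ∧ q y) L
select-select p q []      = refl
select-select p q (y ∷ L) with q y
... | true with p y
...   | true  = cong (y ∷_) (select-select p q L)
...   | false = select-select p q L
select-select p q (y ∷ L) | false with p y
...   | true  = select-select p q L
...   | false = select-select p q L

select-true : ∀ L → select (λ _ → true) L ≡ L
select-true []      = refl
select-true (x ∷ L) = cong (x ∷_) (select-true L)

disjointᵇ-∷ʳ : ∀ x ys F → disjointᵇ ys (x ∷ F) ≡ x ∉ᵇ ys ∧ disjointᵇ ys F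
disjointᵇ-∷ʳ x []       F = refl
disjointᵇ-∷ʳ x (y ∷ ys) F rewrite disjointᵇ-∷ʳ x ys F | ≡ᵇ-sym y x = ∧-interchange (not (x ≡ᵇ y)) (y ∉ᵇ F) (x ∉ᵇ ys) _

unique-disjoint-∷ : ∀ x ys F b → x ∉ᵇ F ≡ true →
  uniqueᵇ (x ∷ ys) ∧ (disjointᵇ (x ∷ ys) F ∧ b) ≡ uniqueᵇ ys ∧ (disjointᵇ ys (x ∷ F) ∧ b)
unique-disjoint-∷ x ys F b x∉F rewrite x∉F | disjointᵇ-∷ʳ x ys F with x ∉ᵇ ys | uniqueᵇ ys
... | true  | _     = refl
... | false | true  = refl
... | false | false = refl

-- F lists the entries already placed, so that uniqueness of the whole list is checked entry by entry.
count-allLists : ∀ n k F P →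
  count (λ ys → uniqueᵇ ys ∧ (disjointᵇ ys F ∧ P ys)) (allLists n k) ≡ #arr k (select (_∉ᵇ F) (upTo n)) P
count-allLists n zero    F P = +-identityʳ (indicator (P []))
count-allLists n (suc k) F P = begin
    count Q (concatMap (λ x → map (x ∷_) (allLists n k)) (upTo n))
  ≡⟨ count-concatMap Q _ (upTo n) ⟩
    sum (map (λ x → count Q (map (x ∷_) (allLists n k))) (upTo n))
  ≡⟨ cong sum (map-cong first-entry (upTo n)) ⟩
    sum (map (λ x → if x ∉ᵇ F then g x else 0) (upTo n))
  ≡⟨ sum-select (_∉ᵇ F) g (upTo n) ⟨
    #arr (suc k) S P ∎
  where
  open ≡-Reasoning
  Q = λ ys → uniqueᵇ ys ∧ (disjointᵇ ys F ∧ P ys)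
  S = select (_∉ᵇ F) (upTo n)
  g = λ x → #arr k (remove x S) (λ ys → P (x ∷ ys))
  first-entry : ∀ x → count Q (map (x ∷_) (allLists n k)) ≡ (if x ∉ᵇ F then g x else 0)
  first-entry x with x ∉ᵇ F in x∉F
  ... | true  = begin
      count Q (map (x ∷_) (allLists n k))
    ≡⟨ count-map Q (x ∷_) (allLists n k) ⟩
      count (Q ∘ (x ∷_)) (allLists n k)
    ≡⟨ count-cong (λ ys → unique-disjoint-∷ x ys F (P (x ∷ ys)) x∉F) (allLists n k) ⟩
      count (λ ys → uniqueᵇ ys ∧ (disjointᵇ ys (x ∷ F) ∧ P (x ∷ ys))) (allLists n k)
    ≡⟨ count-allLists n k (x ∷ F) (λ ys → P (x ∷ ys)) ⟩
      #arr k (select (_∉ᵇ (x ∷ F)) (upTo n)) (λ ys → P (x ∷ ys))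
    ≡⟨ cong (λ L → #arr k L (λ ys → P (x ∷ ys))) (select-select _ (_∉ᵇ F) (upTo n)) ⟨
      g x ∎
  ... | false = trans (count-map Q (x ∷_) (allLists n k))
                      (count-false _ x-excluded (allLists n k))
    where
    x-excluded : ∀ ys → Q (x ∷ ys) ≡ false
    x-excluded ys rewrite x∉F = ∧-zeroʳ (x ∉ᵇ ys ∧ uniqueᵇ ys)

#permutations≡#arr : ∀ n E → length (filterᵇ E (permutations n)) ≡ #arr n (upTo n) E
#permutations≡#arr n E = begin
    length (filterᵇ E (permutations n))
  ≡⟨ length-filterᵇ-unique E (allLists n n) ⟩
    count (λ ys → uniqueᵇ ys ∧ E ys) (allLists n n)
  ≡⟨ count-cong (λ ys → cong (λ b → uniqueᵇ ys ∧ (b ∧ E ys)) (disjointᵇ-[] ys)) (allLists n n) ⟨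
    count (λ ys → uniqueᵇ ys ∧ (disjointᵇ ys [] ∧ E ys)) (allLists n n)
  ≡⟨ count-allLists n n [] E ⟩
    #arr n (select (_∉ᵇ []) (upTo n)) E
  ≡⟨ cong (λ L → #arr n L E) (select-true (upTo n)) ⟩
    #arr n (upTo n) E ∎
  where
  open ≡-Reasoning
  disjointᵇ-[] : ∀ ys → disjointᵇ ys [] ≡ true
  disjointᵇ-[] []       = refl
  disjointᵇ-[] (y ∷ ys) = disjointᵇ-[] ys

insertAt : ℕ → ℕ → List ℕ → List ℕ
insertAt zero    z σ       = z ∷ σ
insertAt (suc i) z []      = z ∷ []
insertAt (suc i) z (x ∷ σ) = x ∷ insertAt i z σ

∑ : ℕ → (ℕ → ℕ) → ℕ
∑ k g = sum (applyUpTo g k)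

syntax ∑ k (λ i → e) = ∑[ i < k ] e

_∈ᵇ_ : ℕ → List ℕ → Set
x ∈ᵇ S = elemᵇ x S ≡ true

remove-∉ : ∀ z S → z ∉ᵇ S ≡ true → remove z S ≡ S
remove-∉ z []      _ = refl
remove-∉ z (y ∷ S) z∉S with z ≡ᵇ y | ≡ᵇ-sym y z
... | false | y≢z rewrite y≢z = cong (y ∷_) (remove-∉ z S (∧-true₂ z∉S))

∉-remove : ∀ z x S → z ∉ᵇ S ≡ true → z ∉ᵇ remove x S ≡ true
∉-remove z x []      _ = refl
∉-remove z x (y ∷ S) z∉S with y ≡ᵇ x
... | true  = ∉-remove z x S (∧-true₂ z∉S)
... | false = cong₂ _∧_ (∧-true₁ z∉S) (∉-remove z x S (∧-true₂ z∉S))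

unique-remove : ∀ x S → uniqueᵇ S ≡ true → uniqueᵇ (remove x S) ≡ true
unique-remove x []      _ = refl
unique-remove x (y ∷ S) u with y ≡ᵇ x
... | true  = unique-remove x S (∧-true₂ u)
... | false = cong₂ _∧_ (∉-remove y x S (∧-true₁ u)) (unique-remove x S (∧-true₂ u))

length-remove : ∀ x S → uniqueᵇ S ≡ true → x ∈ᵇ S → suc (length (remove x S)) ≡ length S
length-remove x (y ∷ S) u x∈S with y ≡ᵇ x in y≡x
... | true  = cong (suc ∘ length) (remove-∉ x S (subst (λ v → v ∉ᵇ S ≡ true) (≡ᵇ-true⇒≡ y≡x) (∧-true₁ u)))
... | false rewrite ≡ᵇ-sym x y | y≡x = cong suc (length-remove x S (∧-true₂ u) x∈S)

∈-remove⇒∈ : ∀ y x S → y ∈ᵇ remove x S → y ∈ᵇ S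
∈-remove⇒∈ y x (z ∷ S) y∈ with z ≡ᵇ x
... | true  rewrite ∈-remove⇒∈ y x S y∈ = ∨-zeroʳ (y ≡ᵇ z)
... | false with y ≡ᵇ z
...   | true  = refl
...   | false = ∈-remove⇒∈ y x S y∈

∉∧∈⇒≢ᵇ : ∀ z x S → z ∉ᵇ S ≡ true → x ∈ᵇ S → (z ≡ᵇ x) ≡ false
∉∧∈⇒≢ᵇ z x (y ∷ S) z∉S x∈S with x ≡ᵇ y in x≡y
... | true with refl ← ≡ᵇ-true⇒≡ {x} {y} x≡y with z ≡ᵇ x
...   | false = refl
∉∧∈⇒≢ᵇ z x (y ∷ S) z∉S x∈S | false = ∉∧∈⇒≢ᵇ z x S (∧-true₂ z∉S) x∈S

∈-self : ∀ S → All (_∈ᵇ S) S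
∈-self []      = []
∈-self (y ∷ S) = cong (_∨ elemᵇ y S) (≡ᵇ-refl y) ∷ All.map (λ {x} x∈S → trans (cong ((x ≡ᵇ y) ∨_) x∈S) (∨-zeroʳ (x ≡ᵇ y))) (∈-self S)

sum-map-+ : ∀ (f g : ℕ → ℕ) L → sum (map (λ x → f x + g x) L) ≡ sum (map f L) + sum (map g L)
sum-map-+ f g []      = refl
sum-map-+ f g (x ∷ L) rewrite sum-map-+ f g L = +-interchange (f x) (g x) (sum (map f L)) (sum (map g L))

sum-map-∑ : ∀ m (h : ℕ → ℕ → ℕ) L → sum (map (λ x → ∑[ i < m ] h x i) L) ≡ ∑[ i < m ] sum (map (λ x → h x i) L)
sum-map-∑ zero    h []      = refl
sum-map-∑ zero    h (x ∷ L) = sum-map-∑ zero h L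
sum-map-∑ (suc m) h L = trans (sum-map-+ (λ x → h x 0) (λ x → ∑[ i < m ] h x (suc i)) L)
                              (cong (sum (map (λ x → h x 0) L) +_) (sum-map-∑ m (λ x i → h x (suc i)) L))

#arr-insert : ∀ k z S P → z ∉ᵇ S ≡ true → uniqueᵇ S ≡ true → length S ≡ k →
  #arr (suc k) (z ∷ S) P ≡ ∑[ i < suc k ] #arr k S (λ σ → P (insertAt i z σ))
#arr-insert zero    z [] P _ _ _ = refl
#arr-insert (suc k) z S P z∉S u l rewrite ≡ᵇ-refl z | remove-∉ z S z∉S =
  cong (#arr (suc k) S (λ ys → P (z ∷ ys)) +_)
    (trans (cong sum (map-cong-local (All.map later-head (∈-self S))))
           (sum-map-∑ (suc k) (λ x i → #arr k (remove x S) (λ σ → P (x ∷ insertAt i z σ))) S))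
  where
  later-head : ∀ {x} → x ∈ᵇ S →
    #arr (suc k) (remove x (z ∷ S)) (λ ys → P (x ∷ ys)) ≡ ∑[ i < suc k ] #arr k (remove x S) (λ σ → P (x ∷ insertAt i z σ))
  later-head {x} x∈S rewrite ∉∧∈⇒≢ᵇ z x S z∉S x∈S =
    #arr-insert k z (remove x S) (λ ys → P (x ∷ ys)) (∉-remove z x S z∉S) (unique-remove x S u)
                (suc-injective (trans (length-remove x S u x∈S) l))

#arr-cong-on : ∀ k S {P P′} → (∀ σ → length σ ≡ k → All (_∈ᵇ S) σ → P σ ≡ P′ σ) → #arr k S P ≡ #arr k S P′
#arr-cong-on zero    S e = cong indicator (e [] refl [])
#arr-cong-on (suc k) S e = cong sum (map-cong-local (All.map agree (∈-self S)))
  where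
  agree : ∀ {x} → x ∈ᵇ S → #arr k (remove x S) _ ≡ #arr k (remove x S) _
  agree {x} x∈S = #arr-cong-on k (remove x S)
    (λ σ l σ⊆ → e (x ∷ σ) (cong suc l) (x∈S ∷ All.map (λ {y} → ∈-remove⇒∈ y x S) σ⊆))

#arr-false : ∀ k S → #arr k S (λ _ → false) ≡ 0
#arr-false zero    S = refl
#arr-false (suc k) S = go S
  where
  go : ∀ L → sum (map (λ x → #arr k (remove x S) (λ _ → false)) L) ≡ 0
  go []      = refl
  go (x ∷ L) rewrite #arr-false k (remove x S) = go L

#arr-true : ∀ k S → uniqueᵇ S ≡ true → length S ≡ k → #arr k S (λ _ → true) ≡ k !
#arr-true zero    S _ _ = refl
#arr-true (suc k) S u l = begin
    sum (map (λ x → #arr k (remove x S) (λ _ → true)) S)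
  ≡⟨ cong sum (map-cong-local (All.map (λ {x} x∈S → #arr-true k (remove x S) (unique-remove x S u)
                                          (suc-injective (trans (length-remove x S u x∈S) l))) (∈-self S))) ⟩
    sum (map (λ _ → k !) S)
  ≡⟨ sum-const S ⟩
    length S * k !
  ≡⟨ cong (_* k !) l ⟩
    suc k * k ! ∎
  where
  open ≡-Reasoning
  sum-const : ∀ (L : List ℕ) → sum (map (λ _ → k !) L) ≡ length L * k !
  sum-const []      = refl
  sum-const (x ∷ L) = cong (k ! +_) (sum-const L)

∑-cong : ∀ k {g h} → (∀ i → i < k → g i ≡ h i) → ∑ k g ≡ ∑ k h
∑-cong zero    e = refl
∑-cong (suc k) e = cong₂ _+_ (e 0 z<s) (∑-cong k (λ i lt → e (suc i) (s<s lt)))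

∑-const : ∀ k {g} c → (∀ i → i < k → g i ≡ c) → ∑ k g ≡ k * c
∑-const zero    c e = refl
∑-const (suc k) c e = cong₂ _+_ (e 0 z<s) (∑-const k c (λ i lt → e (suc i) (s<s lt)))

∑-zero : ∀ k {g} → (∀ i → i < k → g i ≡ 0) → ∑ k g ≡ 0
∑-zero k e = trans (∑-const k 0 e) (*-zeroʳ k)

∑-+ : ∀ p q g → ∑ (p + q) g ≡ ∑ p g + ∑[ i < q ] g (p + i)
∑-+ zero    q g = refl
∑-+ (suc p) q g = trans (cong (g 0 +_) (∑-+ p q (g ∘ suc))) (sym (+-assoc (g 0) _ _))

∑-split : ∀ {p m} g → p ≤ m → ∑ m g ≡ ∑ p g + ∑[ i < m ∸ p ] g (p + i)
∑-split {p} {m} g p≤m = trans (cong (λ k → ∑ k g) (sym (m+[n∸m]≡n p≤m))) (∑-+ p (m ∸ p) g)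

length-insertAt : ∀ j z L → length (insertAt j z L) ≡ suc (length L)
length-insertAt zero    z L       = refl
length-insertAt (suc j) z []      = refl
length-insertAt (suc j) z (x ∷ L) = cong suc (length-insertAt j z L)

All-insertAt : ∀ {P : ℕ → Set} j {z L} → P z → All P L → All P (insertAt j z L)
All-insertAt zero    pz pL        = pz ∷ pL
All-insertAt (suc j) pz []        = pz ∷ []
All-insertAt (suc j) pz (px ∷ pL) = px ∷ All-insertAt j pz pL

∈-insertAt : ∀ j z L → z ∈ᵇ insertAt j z L
∈-insertAt zero    z L       rewrite ≡ᵇ-refl z = refl
∈-insertAt (suc j) z []      rewrite ≡ᵇ-refl z = refl
∈-insertAt (suc j) z (x ∷ L) rewrite ∈-insertAt j z L = ∨-zeroʳ (z ≡ᵇ x)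

take-insertAt-≤ : ∀ j m z τ → j ≤ m → take (suc m) (insertAt j z τ) ≡ insertAt j z (take m τ)
take-insertAt-≤ zero    m       z τ       _         = refl
take-insertAt-≤ (suc j) (suc m) z []      _         = refl
take-insertAt-≤ (suc j) (suc m) z (x ∷ τ) (s≤s j≤m) = cong (x ∷_) (take-insertAt-≤ j m z τ j≤m)

drop-insertAt-≤ : ∀ j m z τ → j ≤ m → drop (suc m) (insertAt j z τ) ≡ drop m τ
drop-insertAt-≤ zero    m       z τ       _         = refl
drop-insertAt-≤ (suc j) (suc m) z []      _         = refl
drop-insertAt-≤ (suc j) (suc m) z (x ∷ τ) (s≤s j≤m) = drop-insertAt-≤ j m z τ j≤m

take-insertAt-≥ : ∀ m i z τ → m ≤ length τ → take m (insertAt (m + i) z τ) ≡ take m τ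
take-insertAt-≥ zero    i z τ       _         = refl
take-insertAt-≥ (suc m) i z (x ∷ τ) (s≤s m≤l) = cong (x ∷_) (take-insertAt-≥ m i z τ m≤l)

drop-insertAt-≥ : ∀ m i z τ → m ≤ length τ → drop m (insertAt (m + i) z τ) ≡ insertAt i z (drop m τ)
drop-insertAt-≥ zero    i z τ       _         = refl
drop-insertAt-≥ (suc m) i z (x ∷ τ) (s≤s m≤l) = drop-insertAt-≥ m i z τ m≤l

≤-length-drop : ∀ a c (τ : List ℕ) → a + c ≤ length τ → c ≤ length (drop a τ)
≤-length-drop zero    c τ       le       = le
≤-length-drop (suc a) c (x ∷ τ) (s≤s le) = ≤-length-drop a c τ le

-- Records in a window

belowAll : ℕ → List ℕ → Bool
belowAll y []      = true
belowAll y (x ∷ u) = (y <ᵇ x) ∧ belowAll y u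

anyᵇ : (ℕ → Bool) → List ℕ → Bool
anyᵇ q []      = false
anyᵇ q (y ∷ w) = q y ∨ anyᵇ q w

-- The minimum of the first a + b entries of σ lies at a position ≥ a.
beatsPrefix : ℕ → ℕ → List ℕ → Bool
beatsPrefix a b σ = anyᵇ (λ y → belowAll y (take a σ)) (take b (drop a σ))

belowAll-insertAt : ∀ y j z u → z ≤ y → belowAll y (insertAt j z u) ≡ false
belowAll-insertAt y zero    z u       z≤y rewrite ≥⇒<ᵇ-false z≤y = refl
belowAll-insertAt y (suc j) z []      z≤y rewrite ≥⇒<ᵇ-false z≤y = refl
belowAll-insertAt y (suc j) z (x ∷ u) z≤y rewrite belowAll-insertAt y j z u z≤y = ∧-zeroʳ (y <ᵇ x)

belowAll-all : ∀ y u → All (y <_) u → belowAll y u ≡ true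
belowAll-all y []      []         = refl
belowAll-all y (x ∷ u) (y<x ∷ pu) rewrite <⇒<ᵇ-true y<x = belowAll-all y u pu

anyᵇ-none : ∀ q {w} → All (λ y → q y ≡ false) w → anyᵇ q w ≡ false
anyᵇ-none q []        = refl
anyᵇ-none q (p ∷ pw) rewrite p = anyᵇ-none q pw

anyᵇ-insertAt : ∀ q i z w → q z ≡ true → anyᵇ q (insertAt i z w) ≡ true
anyᵇ-insertAt q zero    z w       qz rewrite qz = refl
anyᵇ-insertAt q (suc i) z []      qz rewrite qz = refl
anyᵇ-insertAt q (suc i) z (y ∷ w) qz rewrite anyᵇ-insertAt q i z w qz = ∨-zeroʳ (q y)

anyᵇ-cong : ∀ {q q′} {P : ℕ → Set} {w} → All P w → (∀ {y} → P y → q y ≡ q′ y) → anyᵇ q w ≡ anyᵇ q′ w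
anyᵇ-cong []       e = refl
anyᵇ-cong (p ∷ pw) e = cong₂ _∨_ (e p) (anyᵇ-cong pw e)

beatsPrefix-insert-prefix : ∀ a b j z τ → j ≤ a → All (z <_) τ → beatsPrefix (suc a) b (insertAt j z τ) ≡ false
beatsPrefix-insert-prefix a b j z τ j≤a z<τ
  rewrite take-insertAt-≤ j a z τ j≤a | drop-insertAt-≤ j a z τ j≤a =
  anyᵇ-none _ (All.map (λ {y} z<y → belowAll-insertAt y j z (take a τ) (<⇒≤ z<y)) (take⁺ b (drop⁺ a z<τ)))

beatsPrefix-insert-window : ∀ a b i z τ → i < b → a ≤ length τ → All (z <_) τ → beatsPrefix a b (insertAt (a + i) z τ) ≡ true
beatsPrefix-insert-window a (suc b) i z τ (s≤s i≤b) a≤l z<τ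
  rewrite take-insertAt-≥ a i z τ a≤l | drop-insertAt-≥ a i z τ a≤l | take-insertAt-≤ i b z (drop a τ) i≤b =
  anyᵇ-insertAt _ i z (take b (drop a τ)) (belowAll-all z (take a τ) (take⁺ a z<τ))

beatsPrefix-insert-after : ∀ a b i z τ → a + (b + i) ≤ length τ → beatsPrefix a b (insertAt (a + (b + i)) z τ) ≡ beatsPrefix a b τ
beatsPrefix-insert-after a b i z τ le
  rewrite take-insertAt-≥ a (b + i) z τ (m+n≤o⇒m≤o a le) | drop-insertAt-≥ a (b + i) z τ (m+n≤o⇒m≤o a le)
        | take-insertAt-≥ b i z (drop a τ) (m+n≤o⇒m≤o b (≤-length-drop a (b + i) τ le)) = refl

Increasing : (ℕ → ℕ) → Set
Increasing f = ∀ i → f i < f (suc i)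

increasing-head : ∀ {f} → Increasing f → ∀ j → f 0 < f (suc j)
increasing-head inc zero    = inc 0
increasing-head inc (suc j) = <-trans (increasing-head inc j) (inc (suc j))

∈-applyUpTo : ∀ {y} g m → y ∈ᵇ applyUpTo g m → ∃ λ j → j < m × y ≡ g j
∈-applyUpTo {y} g (suc m) y∈ with y ≡ᵇ g 0 in y≡g0
... | true  = 0 , z<s , ≡ᵇ-true⇒≡ y≡g0
... | false with ∈-applyUpTo (g ∘ suc) m y∈
...   | j , j<m , y≡ = suc j , s<s j<m , y≡

∉-below : ∀ z L → All (z <_) L → z ∉ᵇ L ≡ true
∉-below z []      []         = refl
∉-below z (y ∷ L) (z<y ∷ pL) rewrite ∉-below z L pL with z ≡ᵇ y in z≡y
... | false = refl
... | true  = ⊥-elim (<-irrefl (≡ᵇ-true⇒≡ z≡y) z<y)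

unique-increasing : ∀ {f} → Increasing f → ∀ m → uniqueᵇ (applyUpTo f m) ≡ true
unique-increasing inc zero    = refl
unique-increasing {f} inc (suc m)
  rewrite ∉-below (f 0) (applyUpTo (f ∘ suc) m) (applyUpTo⁺₁ (f ∘ suc) m (λ {j} _ → increasing-head inc j)) =
  unique-increasing (inc ∘ suc) m

-- Inserting the minimum z of the items into an arrangement of the others at position j kills the
-- event for j < a, forces it for a ≤ j < a + b, and leaves it unchanged for j ≥ a + b.
#arr-beatsPrefix-step : ∀ a b d {f} → Increasing f → let k = a + b + d in
  #arr (suc k) (applyUpTo f (suc k)) (beatsPrefix (suc a) b)
    ≡ b * k ! + d * #arr k (applyUpTo (f ∘ suc) k) (beatsPrefix (suc a) b)
#arr-beatsPrefix-step a b d {f} inc = begin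
    #arr (suc k) (z ∷ S) (beatsPrefix (suc a) b)
  ≡⟨ #arr-insert k z S (beatsPrefix (suc a) b) (∉-below z S (applyUpTo⁺₁ (f ∘ suc) k (λ {j} _ → increasing-head inc j))) S-unique (length-applyUpTo _ k) ⟩
    ∑ (suc k) g
  ≡⟨ cong (λ m → ∑ m g) (cong suc (+-assoc a b d)) ⟩
    ∑ (suc a + (b + d)) g
  ≡⟨ ∑-+ (suc a) (b + d) g ⟩
    ∑ (suc a) g + ∑ (b + d) (λ i → g (suc a + i))
  ≡⟨ cong₂ _+_ (∑-zero (suc a) prefix) (∑-+ b d (λ i → g (suc a + i))) ⟩
    ∑[ i < b ] g (suc a + i) + ∑[ i < d ] g (suc a + (b + i))
  ≡⟨ cong₂ _+_ (∑-const b (k !) window) (∑-const d _ after) ⟩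
    b * k ! + d * #arr k S (beatsPrefix (suc a) b) ∎
  where
  open ≡-Reasoning
  k = a + b + d
  z = f 0
  S = applyUpTo (f ∘ suc) k
  g : ℕ → ℕ
  g j = #arr k S (λ τ → beatsPrefix (suc a) b (insertAt j z τ))
  S-unique : uniqueᵇ S ≡ true
  S-unique = unique-increasing (inc ∘ suc) k
  z<S : ∀ {τ} → All (_∈ᵇ S) τ → All (z <_) τ
  z<S = All.map (λ τ∈ → z<entry (∈-applyUpTo (f ∘ suc) k τ∈))
    where
    z<entry : ∀ {y} → ∃ (λ j → j < k × y ≡ f (suc j)) → z < y
    z<entry (j , _ , refl) = increasing-head inc j
  prefix : ∀ j → j < suc a → g j ≡ 0
  prefix j (s≤s j≤a) = trans (#arr-cong-on k S (λ τ _ τ⊆S → beatsPrefix-insert-prefix a b j z τ j≤a (z<S τ⊆S))) (#arr-false k S)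
  window : ∀ i → i < b → g (suc a + i) ≡ k !
  window i i<b = trans (#arr-cong-on k S (λ τ l τ⊆S → beatsPrefix-insert-window (suc a) b i z τ i<b
                                                          (subst (suc a ≤_) (sym l) bound)
                                                          (z<S τ⊆S)))
                       (#arr-true k S S-unique (length-applyUpTo _ k))
    where
    bound : suc a ≤ a + b + d
    bound = ≤-trans (subst (_≤ a + b) (+-comm a 1) (+-monoʳ-≤ a (≤-trans (s≤s z≤n) i<b))) (m≤m+n (a + b) d)
  after : ∀ i → i < d → g (suc a + (b + i)) ≡ #arr k S (beatsPrefix (suc a) b)
  after i i<d = #arr-cong-on k S (λ τ l _ → beatsPrefix-insert-after (suc a) b i z τ (subst (_ ≤_) (sym l) bound))
    where
    bound : suc a + (b + i) ≤ a + b + d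
    bound = subst (_≤ a + b + d) (trans (+-suc (a + b) i) (cong suc (+-assoc a b i))) (+-monoʳ-≤ (a + b) i<d)

#arr-beatsPrefix : ∀ a b d {f} → Increasing f → let k = suc a + b + d in
  (suc a + b) * #arr k (applyUpTo f k) (beatsPrefix (suc a) b) ≡ b * k !
#arr-beatsPrefix a b d {f} inc =
  trans (cong ((suc a + b) *_) (#arr-beatsPrefix-step a b d inc)) (arith (suc a + b) b d ((a + b + d) !) _ (smaller d inc))
  where
  arith : ∀ m b d K X → d * (m * X) ≡ d * (b * K) → m * (b * K + d * X) ≡ b * ((m + d) * K)
  arith m b d K X e = begin
      m * (b * K + d * X)        ≡⟨ regroupˡ m b d K X ⟩
      m * (b * K) + d * (m * X)  ≡⟨ cong (m * (b * K) +_) e ⟩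
      m * (b * K) + d * (b * K)  ≡⟨ regroupʳ m b d K ⟩
      b * ((m + d) * K)          ∎
    where
    open ≡-Reasoning
    regroupˡ : ∀ m b d K X → m * (b * K + d * X) ≡ m * (b * K) + d * (m * X)
    regroupˡ = solve-∀
    regroupʳ : ∀ m b d K → m * (b * K) + d * (b * K) ≡ b * ((m + d) * K)
    regroupʳ = solve-∀
  -- Scaled by d, so that the case d = 0, which has no induction hypothesis, is trivial.
  smaller : ∀ d {f} → Increasing f → let k = a + b + d in
    d * ((suc a + b) * #arr k (applyUpTo (f ∘ suc) k) (beatsPrefix (suc a) b)) ≡ d * (b * k !)
  smaller zero     _   = refl
  smaller (suc d′) {f} inc = cong (suc d′ *_)
    (subst (λ k → (suc a + b) * #arr k (applyUpTo (f ∘ suc) k) (beatsPrefix (suc a) b) ≡ b * k !)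
           (sym (+-suc (a + b) d′)) (#arr-beatsPrefix a b d′ (inc ∘ suc)))

-- The behaviour of OPTIMISTIC

minimum : ℕ → List ℕ → ℕ
minimum B = foldr _⊓_ B

best2-best : ∀ B L → proj₁ (best2 B L) ≡ minimum B L
best2-best B []      = refl
best2-best B (x ∷ L) with best2 B L | best2-best B L
... | (a , b) | refl with x <ᵇ a in x<a
...   | true = sym (m≤n⇒m⊓n≡m (<⇒≤ (<ᵇ-true⇒< x<a)))
...   | false with x <ᵇ b
...     | true  = sym (m≥n⇒m⊓n≡n (≮⇒≥ (λ lt → subst T x<a (<⇒<ᵇ lt))))
...     | false = sym (m≥n⇒m⊓n≡n (≮⇒≥ (λ lt → subst T x<a (<⇒<ᵇ lt))))

minimum-glb : ∀ {c} B u → c ≤ B → All (c ≤_) u → c ≤ minimum B u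
minimum-glb B []      c≤B []         = c≤B
minimum-glb B (x ∷ u) c≤B (c≤x ∷ pu) = ⊓-glb c≤x (minimum-glb B u c≤B pu)

<ᵇ-⊓ : ∀ y x m → (y <ᵇ (x ⊓ m)) ≡ (y <ᵇ x) ∧ (y <ᵇ m)
<ᵇ-⊓ y x m with ≤-total x m
... | inj₁ x≤m rewrite m≤n⇒m⊓n≡m x≤m with y <ᵇ x in y<x
...   | false = refl
...   | true  = sym (<⇒<ᵇ-true (<-≤-trans (<ᵇ-true⇒< y<x) x≤m))
<ᵇ-⊓ y x m | inj₂ m≤x rewrite m≥n⇒m⊓n≡n m≤x with y <ᵇ m in y<m
...   | false = sym (∧-zeroʳ (y <ᵇ x))
...   | true  rewrite <⇒<ᵇ-true (<-≤-trans (<ᵇ-true⇒< y<m) m≤x) = refl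

belowAll-minimum : ∀ y B u → y < B → belowAll y u ≡ (y <ᵇ minimum B u)
belowAll-minimum y B []      y<B = sym (<⇒<ᵇ-true y<B)
belowAll-minimum y B (x ∷ u) y<B rewrite <ᵇ-⊓ y x (minimum B u) = cong ((y <ᵇ x) ∧_) (belowAll-minimum y B u y<B)

best2-insertAt-1 : ∀ B p L → All (2 ≤_) L → 2 ≤ B → best2 B (insertAt p 1 L) ≡ (1 , minimum B L)
best2-insertAt-1 B zero L 2≤L 2≤B with best2 B L | best2-best B L
... | (m , b) | refl rewrite <⇒<ᵇ-true {1} {minimum B L} (minimum-glb B L 2≤B 2≤L) = refl
best2-insertAt-1 B (suc p) []      _                   (s≤s (s≤s _)) = refl
best2-insertAt-1 B (suc p) (x ∷ L) (s≤s (s≤s _) ∷ 2≤L) 2≤B rewrite best2-insertAt-1 B p L 2≤L 2≤B with x <ᵇ minimum B L in x<m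
... | true  = cong (1 ,_) (sym (m≤n⇒m⊓n≡m (<⇒≤ (<ᵇ-true⇒< x<m))))
... | false = cong (1 ,_) (sym (m≥n⇒m⊓n≡n (≮⇒≥ (λ lt → subst T x<m (<⇒<ᵇ lt)))))

firstBetter-1-insertAt-0 : ∀ j D → All (2 ≤_) D → firstBetter 1 (insertAt j 0 D) ≡ just (0 , drop j D)
firstBetter-1-insertAt-0 zero    D       _                  = refl
firstBetter-1-insertAt-0 (suc j) []      _                  = refl
firstBetter-1-insertAt-0 (suc j) (x ∷ D) (s≤s (s≤s _) ∷ 2≤D) = firstBetter-1-insertAt-0 j D 2≤D

firstBetter-1-none : ∀ D → All (2 ≤_) D → firstBetter 1 D ≡ nothing
firstBetter-1-none []      _                   = refl
firstBetter-1-none (x ∷ D) (s≤s (s≤s _) ∷ 2≤D) = firstBetter-1-none D 2≤D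

firstBetter-beaten : ∀ s j D → All (2 ≤_) D → anyᵇ (_<ᵇ s) (take j D) ≡ true →
  Σ ℕ λ a → Σ ℕ λ j′ → Σ (List ℕ) λ D′ →
    (firstBetter s (insertAt j 0 D) ≡ just (a , insertAt j′ 0 D′)) × 2 ≤ a × All (2 ≤_) D′
firstBetter-beaten s (suc j) (x ∷ D) (2≤x ∷ 2≤D) beaten with x <ᵇ s
... | true  = x , j , D , refl , 2≤x , 2≤D
... | false = firstBetter-beaten s j D 2≤D beaten

firstBetter-unbeaten : ∀ s j D → anyᵇ (_<ᵇ s) (take j D) ≡ false → 0 < s →
  firstBetter s (insertAt j 0 D) ≡ just (0 , drop j D)
firstBetter-unbeaten (suc s) zero    D       _        _ = refl
firstBetter-unbeaten (suc s) (suc j) []      _        _ = refl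
firstBetter-unbeaten (suc s) (suc j) (x ∷ D) unbeaten 0<s with x <ᵇ suc s
... | false = firstBetter-unbeaten (suc s) j D unbeaten 0<s

firstBetter-All : ∀ {P : ℕ → Set} s L {a rest} → All P L → firstBetter s L ≡ just (a , rest) → P a × All P rest
firstBetter-All s (x ∷ L) (px ∷ pL) e with x <ᵇ s
firstBetter-All s (x ∷ L) (px ∷ pL) refl | true = px , pL
... | false = firstBetter-All s L pL e

optimistic2-after-sample : ∀ {P : ℕ → Set} n t π → All P (drop (t ∸ 1) π) → All P (optimistic2 n t π)
optimistic2-after-sample n t π pπ with best2 n (take (t ∸ 1) π)
... | (s₁ , s₂) with firstBetter s₂ (drop (t ∸ 1) π) in e₁
...   | nothing = []
...   | just (a , rest) with firstBetter-All s₂ (drop (t ∸ 1) π) pπ e₁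
...     | pa , prest with firstBetter s₁ rest in e₂
...       | nothing      = pa ∷ []
...       | just (b , r) = pa ∷ proj₁ (firstBetter-All s₁ rest prest e₂) ∷ []

optimistic2-two : ∀ n t π {s₁ s₂ a rest b r} → best2 n (take (t ∸ 1) π) ≡ (s₁ , s₂) →
  firstBetter s₂ (drop (t ∸ 1) π) ≡ just (a , rest) → firstBetter s₁ rest ≡ just (b , r) → optimistic2 n t π ≡ a ∷ b ∷ []
optimistic2-two n t π e₁ e₂ e₃ rewrite e₁ | e₂ | e₃ = refl

optimistic2-one : ∀ n t π {s₁ s₂ a rest} → best2 n (take (t ∸ 1) π) ≡ (s₁ , s₂) →
  firstBetter s₂ (drop (t ∸ 1) π) ≡ just (a , rest) → firstBetter s₁ rest ≡ nothing → optimistic2 n t π ≡ a ∷ []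
optimistic2-one n t π e₁ e₂ e₃ rewrite e₁ | e₂ | e₃ = refl

∉ᵇ-elemᵇ : ∀ v L → All (λ y → (v ≡ᵇ y) ≡ false) L → elemᵇ v L ≡ false
∉ᵇ-elemᵇ v []       []       = refl
∉ᵇ-elemᵇ v (y ∷ L) (p ∷ pL) rewrite p = ∉ᵇ-elemᵇ v L pL

pos-≤ : ∀ v m π → v ∈ᵇ take m π → pos v π ≤ m
pos-≤ v (suc m) (x ∷ π) v∈ with v ≡ᵇ x
... | true  = s≤s z≤n
... | false = s≤s (pos-≤ v m π v∈)

pos-> : ∀ v m π → elemᵇ v (take m π) ≡ false → m ≤ length π → m < pos v π
pos-> v zero    []      _    _        = s≤s z≤n
pos-> v zero    (x ∷ π) _    _ with v ≡ᵇ x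
... | true  = s≤s z≤n
... | false = s≤s z≤n
pos-> v (suc m) (x ∷ π) v∉ (s≤s m≤l) with v ≡ᵇ x
... | false = s≤s (pos-> v m π v∉ m≤l)

inP₁∖P₁′ : ℕ → ℕ → List ℕ → Bool
inP₁∖P₁′ n t π = inP₁ n t π ∧ not (inP₁' n t π)

event-unaccepted : ∀ n t π → inP₁ n t π ≡ false → inP₁∖P₁′ n t π ≡ false
event-unaccepted n t π e rewrite e = refl

event-v₂-late : ∀ n t π → (pos 1 π <ᵇ t) ≡ false → inP₁∖P₁′ n t π ≡ false
event-v₂-late n t π e rewrite e with inP₁ n t π
... | true  = refl
... | false = refl

event-v₂-early : ∀ n t π {A} → optimistic2 n t π ≡ A → (pos 1 π <ᵇ t) ≡ true →
  inP₁∖P₁′ n t π ≡ elemᵇ 0 A ∧ not (firstAcceptedIs 0 A)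
event-v₂-early n t π {A} e₁ e₂ rewrite e₁ | e₂ with elemᵇ 0 A
... | true  = refl
... | false = refl

-- Once v₂ is sampled it is s₁, so the second acceptance can only be v₁; v₁ is then accepted second
-- exactly when one of the i₀ items between the sample and v₁ beats s₂, the best other sampled item.
event-v₂-in-sample : ∀ n A π p u i₀ D → 2 ≤ n → All (2 ≤_) u → All (2 ≤_) D →
  take (suc A) π ≡ insertAt p 1 u → drop (suc A) π ≡ insertAt i₀ 0 D →
  inP₁∖P₁′ n (suc (suc A)) π ≡ anyᵇ (_<ᵇ minimum n u) (take i₀ D)
event-v₂-in-sample n A π p u i₀ D 2≤n 2≤u 2≤D sample after = by-cases _ refl
  where
  t = suc (suc A)
  s₂ = minimum n u
  best : best2 n (take (suc A) π) ≡ (1 , s₂)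
  best = trans (cong (best2 n) sample) (best2-insertAt-1 n p u 2≤u 2≤n)
  v₂-early : (pos 1 π <ᵇ t) ≡ true
  v₂-early = <⇒<ᵇ-true (s≤s (pos-≤ 1 (suc A) π (trans (cong (elemᵇ 1) sample) (∈-insertAt p 1 u))))
  by-cases : ∀ b → anyᵇ (_<ᵇ s₂) (take i₀ D) ≡ b → inP₁∖P₁′ n t π ≡ b
  by-cases true beaten with firstBetter-beaten s₂ i₀ D 2≤D beaten
  ... | a , j′ , D′ , first , s≤s (s≤s _) , 2≤D′ =
    event-v₂-early n t π (optimistic2-two n t π best (trans (cong (firstBetter s₂) after) first)
                                          (firstBetter-1-insertAt-0 j′ D′ 2≤D′))
                   v₂-early
  by-cases false unbeaten =
    event-v₂-early n t π (optimistic2-one n t π best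
                            (trans (cong (firstBetter s₂) after)
                                   (firstBetter-unbeaten s₂ i₀ D unbeaten (≤-trans (s≤s z≤n) (minimum-glb n u 2≤n 2≤u))))
                            (firstBetter-1-none (drop i₀ D) (drop⁺ i₀ 2≤D)))
                   v₂-early

≢ᵇ-item : ∀ {v y} → v < 2 → 2 ≤ y → (v ≡ᵇ y) ≡ false
≢ᵇ-item {zero}  _             (s≤s (s≤s _)) = refl
≢ᵇ-item {suc zero} _          (s≤s (s≤s _)) = refl
≢ᵇ-item {suc (suc v)} (s≤s (s≤s ())) _

event-insert-v₁-early : ∀ n A i p σ → i ≤ A → All (2 ≤_) σ →
  inP₁∖P₁′ n (suc (suc A)) (insertAt i 0 (insertAt p 1 σ)) ≡ false
event-insert-v₁-early n A i p σ i≤A 2≤σ = event-unaccepted n t π (∉ᵇ-elemᵇ 0 _ (optimistic2-after-sample n t π v₁-sampled))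
  where
  t = suc (suc A)
  π = insertAt i 0 (insertAt p 1 σ)
  v₁-sampled : All (λ y → (0 ≡ᵇ y) ≡ false) (drop (suc A) π)
  v₁-sampled = subst (All _) (sym (drop-insertAt-≤ i A 0 (insertAt p 1 σ) i≤A))
                     (drop⁺ A (All-insertAt p refl (All.map (≢ᵇ-item (s≤s z≤n)) 2≤σ)))

event-insert-v₂-late : ∀ n A i₀ p₀ σ → suc A ≤ length σ → All (2 ≤_) σ →
  inP₁∖P₁′ n (suc (suc A)) (insertAt (suc A + i₀) 0 (insertAt (suc A + p₀) 1 σ)) ≡ false
event-insert-v₂-late n A i₀ p₀ σ A<l 2≤σ = event-v₂-late n (suc (suc A)) π (≥⇒<ᵇ-false (pos-> 1 (suc A) π v₂-unsampled A<lπ))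
  where
  σ′ = insertAt (suc A + p₀) 1 σ
  π = insertAt (suc A + i₀) 0 σ′
  A<lσ′ : suc A ≤ length σ′
  A<lσ′ = subst (suc A ≤_) (sym (length-insertAt (suc A + p₀) 1 σ)) (m≤n⇒m≤1+n A<l)
  A<lπ : suc A ≤ length π
  A<lπ = subst (suc A ≤_) (sym (length-insertAt (suc A + i₀) 0 σ′)) (m≤n⇒m≤1+n A<lσ′)
  v₂-unsampled : elemᵇ 1 (take (suc A) π) ≡ false
  v₂-unsampled rewrite take-insertAt-≥ (suc A) i₀ 0 σ′ A<lσ′ | take-insertAt-≥ (suc A) p₀ 1 σ A<l =
    ∉ᵇ-elemᵇ 1 _ (take⁺ (suc A) (All.map (≢ᵇ-item (s≤s (s≤s z≤n))) 2≤σ))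

event-insert-v₂-early : ∀ n A i₀ p σ → 2 ≤ n → p ≤ A → A ≤ length σ → All (2 ≤_) σ → All (_< n) σ →
  inP₁∖P₁′ n (suc (suc A)) (insertAt (suc A + i₀) 0 (insertAt p 1 σ)) ≡ beatsPrefix A i₀ σ
event-insert-v₂-early n A i₀ p σ 2≤n p≤A A≤l 2≤σ σ<n =
  trans (event-v₂-in-sample n A π p (take A σ) i₀ (drop A σ) 2≤n (take⁺ A 2≤σ) (drop⁺ A 2≤σ) sample after)
        (sym (anyᵇ-cong (take⁺ i₀ (drop⁺ A σ<n)) (λ {y} y<n → belowAll-minimum y n (take A σ) y<n)))
  where
  σ′ = insertAt p 1 σ
  π = insertAt (suc A + i₀) 0 σ′
  A<lσ′ : suc A ≤ length σ′
  A<lσ′ = subst (suc A ≤_) (sym (length-insertAt p 1 σ)) (s≤s A≤l)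
  sample : take (suc A) π ≡ insertAt p 1 (take A σ)
  sample = trans (take-insertAt-≥ (suc A) i₀ 0 σ′ A<lσ′) (take-insertAt-≤ p A 1 σ p≤A)
  after : drop (suc A) π ≡ insertAt i₀ 0 (drop A σ)
  after = trans (drop-insertAt-≥ (suc A) i₀ 0 σ′ A<lσ′) (cong (insertAt i₀ 0) (drop-insertAt-≤ p A 1 σ p≤A))

-- Counting the event

#arr-insert-v₁-v₂ : ∀ m P → #arr (2 + m) (upTo (2 + m)) P
  ≡ ∑[ i < 2 + m ] ∑[ p < suc m ] #arr m (applyUpTo (suc ∘ suc) m) (λ σ → P (insertAt i 0 (insertAt p 1 σ)))
#arr-insert-v₁-v₂ m P =
  trans (#arr-insert (suc m) 0 S₁ P (∉-below 0 S₁ (applyUpTo⁺₁ suc (suc m) (λ _ → z<s)))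
                     (unique-increasing {suc} (λ _ → ≤-refl) (suc m)) (length-applyUpTo suc (suc m)))
        (∑-cong (2 + m) (λ i _ → #arr-insert m 1 S₂ (λ σ → P (insertAt i 0 σ))
                                   (∉-below 1 S₂ (applyUpTo⁺₁ (suc ∘ suc) m (λ _ → s<s z<s)))
                                   (unique-increasing {suc ∘ suc} (λ _ → ≤-refl) m) (length-applyUpTo (suc ∘ suc) m)))
  where
  S₁ = applyUpTo suc (suc m)
  S₂ = applyUpTo (suc ∘ suc) m

∈-items : ∀ m {y} → y ∈ᵇ applyUpTo (suc ∘ suc) m → 2 ≤ y × y < 2 + m
∈-items m y∈ with ∈-applyUpTo (suc ∘ suc) m y∈
... | j , j<m , refl = s≤s (s≤s z≤n) , s≤s (s≤s j<m)

#arr-event : ∀ m a → 2 + a ≤ m → let n = 2 + m ; r = 2 + a ; S = applyUpTo (suc ∘ suc) m in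
  #arr n (upTo n) (inP₁∖P₁′ n (suc r)) ≡ ∑[ i₀ < n ∸ r ] (r * #arr m S (beatsPrefix (suc a) i₀))
#arr-event m a r≤m = begin
    #arr n (upTo n) (inP₁∖P₁′ n t)
  ≡⟨ #arr-insert-v₁-v₂ m (inP₁∖P₁′ n t) ⟩
    ∑[ i < n ] ∑[ p < suc m ] g i p
  ≡⟨ ∑-split (λ i → ∑[ p < suc m ] g i p) (≤-trans r≤m (≤-trans (n≤1+n m) (n≤1+n (suc m)))) ⟩
    ∑[ i < r ] ∑[ p < suc m ] g i p + ∑[ i₀ < n ∸ r ] ∑[ p < suc m ] g (r + i₀) p
  ≡⟨ cong₂ _+_ (∑-zero r (λ i i<r → ∑-zero (suc m) (λ p _ → v₁-early i (≤-pred i<r) p)))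
               (∑-cong (n ∸ r) (λ i₀ _ → v₁-late i₀)) ⟩
    ∑[ i₀ < n ∸ r ] (r * #arr m S (beatsPrefix (suc a) i₀)) ∎
  where
  open ≡-Reasoning
  n = 2 + m
  r = 2 + a
  t = suc r
  S = applyUpTo (suc ∘ suc) m
  g : ℕ → ℕ → ℕ
  g i p = #arr m S (λ σ → inP₁∖P₁′ n t (insertAt i 0 (insertAt p 1 σ)))
  ≥2 : ∀ {σ} → All (_∈ᵇ S) σ → All (2 ≤_) σ
  ≥2 = All.map (proj₁ ∘ ∈-items m)
  <n : ∀ {σ} → All (_∈ᵇ S) σ → All (_< n) σ
  <n = All.map (proj₂ ∘ ∈-items m)
  v₁-early : ∀ i → i ≤ suc a → ∀ p → g i p ≡ 0
  v₁-early i i≤A p = trans (#arr-cong-on m S (λ σ _ σ⊆S → event-insert-v₁-early n (suc a) i p σ i≤A (≥2 σ⊆S))) (#arr-false m S)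
  v₁-late : ∀ i₀ → ∑[ p < suc m ] g (r + i₀) p ≡ r * #arr m S (beatsPrefix (suc a) i₀)
  v₁-late i₀ = begin
      ∑[ p < suc m ] g (r + i₀) p
    ≡⟨ ∑-split (g (r + i₀)) (m≤n⇒m≤1+n r≤m) ⟩
      ∑[ p < r ] g (r + i₀) p + ∑[ p₀ < suc m ∸ r ] g (r + i₀) (r + p₀)
    ≡⟨ cong₂ _+_ (∑-const r _ (λ p p<r → #arr-cong-on m S (λ σ l σ⊆S →
                   event-insert-v₂-early n (suc a) i₀ p σ (s≤s (s≤s z≤n)) (≤-pred p<r) (A≤l {σ} l) (≥2 σ⊆S) (<n σ⊆S))))
                 (∑-zero (suc m ∸ r) (λ p₀ _ → trans (#arr-cong-on m S (λ σ l σ⊆S →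
                   event-insert-v₂-late n (suc a) i₀ p₀ σ (subst (r ≤_) (sym l) r≤m) (≥2 σ⊆S))) (#arr-false m S))) ⟩
      r * #arr m S (beatsPrefix (suc a) i₀) + 0
    ≡⟨ +-identityʳ (r * #arr m S (beatsPrefix (suc a) i₀)) ⟩
      r * #arr m S (beatsPrefix (suc a) i₀) ∎
    where
    A≤l : ∀ {σ : List ℕ} → length σ ≡ m → suc a ≤ length σ
    A≤l l = subst (suc a ≤_) (sym l) (≤-trans (n≤1+n (suc a)) r≤m)

-- Fractions and sums

frac≃mkℚᵘ : ∀ a b → toℚᵘ (frac a (suc b)) ≃ mkℚᵘ (ℤ.+ a) b
frac≃mkℚᵘ a b = ℚ.toℚᵘ-fromℚᵘ (mkℚᵘ (ℤ.+ a) b)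

frac-cross : ∀ a b c d → .{{NonZero b}} → .{{NonZero d}} → a * d ≡ c * b → frac a b ≡ frac c d
frac-cross a (suc b) c (suc d) e =
  ℚ.fromℚᵘ-cong {mkℚᵘ (ℤ.+ a) b} {mkℚᵘ (ℤ.+ c) d} (*≡* (trans (sym (ℤ.pos-* a (suc d))) (trans (cong ℤ.+_ e) (ℤ.pos-* c (suc b)))))

frac-+ : ∀ a b c d → .{{NonZero b}} → .{{NonZero d}} → frac a b +ℚ frac c d ≡ frac (a * d + c * b) (b * d)
frac-+ a (suc b) c (suc d) =
  ℚ.toℚᵘ-injective (ℚᵘ.≃-trans (ℚ.toℚᵘ-homo-+ (frac a (suc b)) (frac c (suc d)))
    (ℚᵘ.≃-trans (ℚᵘ.+-cong (frac≃mkℚᵘ a b) (frac≃mkℚᵘ c d)) (ℚᵘ.≃-trans sum≃ (ℚᵘ.≃-sym (frac≃mkℚᵘ _ _)))))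
  where
  sum≃ : mkℚᵘ (ℤ.+ a) b ℚᵘ.+ mkℚᵘ (ℤ.+ c) d ≃ mkℚᵘ (ℤ.+ (a * suc d + c * suc b)) (d + b * suc d)
  sum≃ = *≡* (cong (ℤ._* (ℤ.+ suc (d + b * suc d)))
                   (trans (cong₂ ℤ._+_ (sym (ℤ.pos-* a (suc d))) (sym (ℤ.pos-* c (suc b)))) (sym (ℤ.pos-+ (a * suc d) (c * suc b)))))

frac-* : ∀ a b c d → .{{NonZero b}} → .{{NonZero d}} → frac a b *ℚ frac c d ≡ frac (a * c) (b * d)
frac-* a (suc b) c (suc d) =
  ℚ.toℚᵘ-injective (ℚᵘ.≃-trans (ℚ.toℚᵘ-homo-* (frac a (suc b)) (frac c (suc d)))
    (ℚᵘ.≃-trans (ℚᵘ.*-cong (frac≃mkℚᵘ a b) (frac≃mkℚᵘ c d)) (ℚᵘ.≃-trans product≃ (ℚᵘ.≃-sym (frac≃mkℚᵘ _ _)))))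
  where
  product≃ : mkℚᵘ (ℤ.+ a) b ℚᵘ.* mkℚᵘ (ℤ.+ c) d ≃ mkℚᵘ (ℤ.+ (a * c)) (d + b * suc d)
  product≃ = *≡* (cong (ℤ._* (ℤ.+ suc (d + b * suc d))) (sym (ℤ.pos-* a c)))

frac-zero : ∀ b → frac 0 b ≡ 0ℚ
frac-zero zero    = refl
frac-zero (suc b) = frac-cross 0 (suc b) 0 1 refl

frac-+-numerator : ∀ x y b → frac (x + y) b ≡ frac x b +ℚ frac y b
frac-+-numerator x y zero    = sym (ℚ.+-identityʳ 0ℚ)
frac-+-numerator x y (suc b) = sym (trans (frac-+ x (suc b) y (suc b)) (frac-cross (x * suc b + y * suc b) (suc b * suc b) (x + y) (suc b) (regroup x y b)))
  where
  regroup : ∀ x y b → (x * suc b + y * suc b) * suc b ≡ (x + y) * (suc b * suc b)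
  regroup = solve-∀

∑ℚ : ℕ → (ℕ → ℚ) → ℚ
∑ℚ k g = sumℚ (applyUpTo g k)

syntax ∑ℚ k (λ i → e) = ∑ℚ[ i < k ] e

∑ℚ-cong : ∀ k {g h} → (∀ i → i < k → g i ≡ h i) → ∑ℚ k g ≡ ∑ℚ k h
∑ℚ-cong zero    e = refl
∑ℚ-cong (suc k) e = cong₂ _+ℚ_ (e 0 z<s) (∑ℚ-cong k (λ i lt → e (suc i) (s<s lt)))

∑ℚ-last : ∀ k g → ∑ℚ (suc k) g ≡ ∑ℚ k g +ℚ g k
∑ℚ-last zero    g = trans (ℚ.+-identityʳ (g 0)) (sym (ℚ.+-identityˡ (g 0)))
∑ℚ-last (suc k) g = trans (cong (g 0 +ℚ_) (∑ℚ-last k (g ∘ suc))) (sym (ℚ.+-assoc (g 0) _ _))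

∑ℚ-+ : ∀ k f g → ∑ℚ[ i < k ] (f i +ℚ g i) ≡ ∑ℚ k f +ℚ ∑ℚ k g
∑ℚ-+ zero    f g = sym (ℚ.+-identityʳ 0ℚ)
∑ℚ-+ (suc k) f g rewrite ∑ℚ-+ k (f ∘ suc) (g ∘ suc) = +ℚ-interchange (f 0) (g 0) (∑ℚ k (f ∘ suc)) (∑ℚ k (g ∘ suc))

∑ℚ-*ˡ : ∀ k c f → ∑ℚ[ i < k ] (c *ℚ f i) ≡ c *ℚ ∑ℚ k f
∑ℚ-*ˡ zero    c f = sym (ℚ.*-zeroʳ c)
∑ℚ-*ˡ (suc k) c f rewrite ∑ℚ-*ˡ k c (f ∘ suc) = sym (ℚ.*-distribˡ-+ c (f 0) _)

frac-∑ : ∀ k g d → frac (∑ k g) d ≡ ∑ℚ[ j < k ] frac (g j) d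
frac-∑ zero    g d = frac-zero d
frac-∑ (suc k) g d = trans (frac-+-numerator (g 0) _ d) (cong (frac (g 0) d +ℚ_) (frac-∑ k (g ∘ suc) d))

-- A telescoping sum: the terms are 1/(A+j) − 1/(A+j+1).
∑1/[A+j][A+j+1]≡e/[A[A+e]] : ∀ a e →
  ∑ℚ[ j < e ] frac 1 ((suc a + j) * (suc (suc a) + j)) ≡ frac e (suc a * (suc a + e))
∑1/[A+j][A+j+1]≡e/[A[A+e]] a zero    = sym (frac-zero (suc a * (suc a + 0)))
∑1/[A+j][A+j+1]≡e/[A[A+e]] a (suc e) = begin
    ∑ℚ[ j < suc e ] frac 1 (D j)
  ≡⟨ ∑ℚ-last e (λ j → frac 1 (D j)) ⟩
    ∑ℚ[ j < e ] frac 1 (D j) +ℚ frac 1 (D e)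
  ≡⟨ cong (_+ℚ frac 1 (D e)) (∑1/[A+j][A+j+1]≡e/[A[A+e]] a e) ⟩
    frac e (suc a * (suc a + e)) +ℚ frac 1 (D e)
  ≡⟨ frac-+ e (suc a * (suc a + e)) 1 (D e) ⟩
    frac (e * D e + 1 * (suc a * (suc a + e))) (suc a * (suc a + e) * D e)
  ≡⟨ frac-cross (e * D e + 1 * (suc a * (suc a + e))) (suc a * (suc a + e) * D e) (suc e) (suc a * (suc a + suc e)) (cross a e) ⟩
    frac (suc e) (suc a * (suc a + suc e)) ∎
  where
  open ≡-Reasoning
  D : ℕ → ℕ
  D j = (suc a + j) * (suc (suc a) + j)
  cross : ∀ a e → (e * ((suc a + e) * (suc (suc a) + e)) + 1 * (suc a * (suc a + e))) * (suc a * (suc a + suc e))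
                ≡ suc e * (suc a * (suc a + e) * ((suc a + e) * (suc (suc a) + e)))
  cross = solve-∀

∑[1+e∸j]/[A+j][A+j+1]-split : ∀ a e → let D = λ j → (suc a + j) * (suc (suc a) + j) in
  ∑ℚ[ j < suc e ] frac (suc e ∸ j) (D j) ≡ ∑ℚ[ j < e ] frac (e ∸ j) (D j) +ℚ ∑ℚ[ j < suc e ] frac 1 (D j)
∑[1+e∸j]/[A+j][A+j+1]-split a e = begin
    ∑ℚ[ j < suc e ] frac (suc e ∸ j) (D j)
  ≡⟨ ∑ℚ-cong (suc e) (λ j j≤e → trans (cong (λ x → frac x (D j)) (trans (+-∸-assoc 1 (≤-pred j≤e)) (+-comm 1 (e ∸ j))))
                                      (frac-+-numerator (e ∸ j) 1 (D j))) ⟩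
    ∑ℚ[ j < suc e ] (frac (e ∸ j) (D j) +ℚ frac 1 (D j))
  ≡⟨ ∑ℚ-+ (suc e) (λ j → frac (e ∸ j) (D j)) (λ j → frac 1 (D j)) ⟩
    ∑ℚ[ j < suc e ] frac (e ∸ j) (D j) +ℚ ∑ℚ[ j < suc e ] frac 1 (D j)
  ≡⟨ cong (_+ℚ ∑ℚ[ j < suc e ] frac 1 (D j)) last-vanishes ⟩
    ∑ℚ[ j < e ] frac (e ∸ j) (D j) +ℚ ∑ℚ[ j < suc e ] frac 1 (D j) ∎
  where
  open ≡-Reasoning
  D : ℕ → ℕ
  D j = (suc a + j) * (suc (suc a) + j)
  R : ℚ
  last-vanishes : ∑ℚ[ j < suc e ] frac (e ∸ j) (D j) ≡ ∑ℚ[ j < e ] frac (e ∸ j) (D j)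
  R = ∑ℚ[ j < e ] frac (e ∸ j) (D j)
  last-vanishes = begin
      ∑ℚ[ j < suc e ] frac (e ∸ j) (D j)  ≡⟨ ∑ℚ-last e (λ j → frac (e ∸ j) (D j)) ⟩
      R +ℚ frac (e ∸ e) (D e)             ≡⟨ cong (λ x → R +ℚ frac x (D e)) (n∸n≡0 e) ⟩
      R +ℚ frac 0 (D e)                   ≡⟨ cong (R +ℚ_) (frac-zero (D e)) ⟩
      R +ℚ 0ℚ                             ≡⟨ ℚ.+-identityʳ R ⟩
      R                                   ∎

-- Both sides grow by (e+1)/(A+e+1) when e increases by one: on the right, by A times the telescoping sum.
∑j/[A+j]≡A∑[e∸j]/[A+j][A+j+1] : ∀ a e →
  ∑ℚ[ j < suc e ] frac j (suc a + j) ≡ frac (suc a) 1 *ℚ ∑ℚ[ j < e ] frac (e ∸ j) ((suc a + j) * (suc (suc a) + j))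
∑j/[A+j]≡A∑[e∸j]/[A+j][A+j+1] a zero    = trans (cong (_+ℚ 0ℚ) (frac-zero (suc a + 0))) (sym (ℚ.*-zeroʳ (frac (suc a) 1)))
∑j/[A+j]≡A∑[e∸j]/[A+j][A+j+1] a (suc e) = begin
    ∑ℚ[ j < suc (suc e) ] frac j (suc a + j)
  ≡⟨ ∑ℚ-last (suc e) (λ j → frac j (suc a + j)) ⟩
    ∑ℚ[ j < suc e ] frac j (suc a + j) +ℚ frac (suc e) (suc a + suc e)
  ≡⟨ cong₂ _+ℚ_ (∑j/[A+j]≡A∑[e∸j]/[A+j][A+j+1] a e) (sym A*telescope) ⟩
    A *ℚ R e +ℚ A *ℚ ∑ℚ[ j < suc e ] frac 1 (D j)
  ≡⟨ ℚ.*-distribˡ-+ A (R e) _ ⟨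
    A *ℚ (R e +ℚ ∑ℚ[ j < suc e ] frac 1 (D j))
  ≡⟨ cong (A *ℚ_) (∑[1+e∸j]/[A+j][A+j+1]-split a e) ⟨
    A *ℚ R (suc e) ∎
  where
  open ≡-Reasoning
  A = frac (suc a) 1
  D : ℕ → ℕ
  D j = (suc a + j) * (suc (suc a) + j)
  R : ℕ → ℚ
  R e = ∑ℚ[ j < e ] frac (e ∸ j) (D j)
  A*telescope : A *ℚ ∑ℚ[ j < suc e ] frac 1 (D j) ≡ frac (suc e) (suc a + suc e)
  A*telescope = begin
      A *ℚ ∑ℚ[ j < suc e ] frac 1 (D j)            ≡⟨ cong (A *ℚ_) (∑1/[A+j][A+j+1]≡e/[A[A+e]] a (suc e)) ⟩
      A *ℚ frac (suc e) (suc a * (suc a + suc e))  ≡⟨ frac-* (suc a) 1 (suc e) (suc a * (suc a + suc e)) ⟩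
      frac (suc a * suc e) (1 * (suc a * (suc a + suc e)))  ≡⟨ frac-cross (suc a * suc e) (1 * (suc a * (suc a + suc e))) (suc e) (suc a + suc e) (cancel a e) ⟩
      frac (suc e) (suc a + suc e) ∎
    where
    cancel : ∀ a e → suc a * suc e * (suc a + suc e) ≡ suc e * (1 * (suc a * (suc a + suc e)))
    cancel = solve-∀

-- The probability

δ : ℕ → ℕ → ℚ
δ n t = (frac (t ∸ 1) n *ℚ frac (t ∸ 2) (n ∸ 1)) *ℚ sumℚ (map (λ i → frac (n ∸ i) ((i ∸ 2) * (i ∸ 1))) (range t n))

#arr-beatsPrefix-items : ∀ m a j → suc a + j ≤ m →
  (suc a + j) * #arr m (applyUpTo (suc ∘ suc) m) (beatsPrefix (suc a) j) ≡ j * m !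
#arr-beatsPrefix-items m a j le =
  subst (λ k → (suc a + j) * #arr k (applyUpTo (suc ∘ suc) k) (beatsPrefix (suc a) j) ≡ j * k !)
        (m+[n∸m]≡n le) (#arr-beatsPrefix a j (m ∸ (suc a + j)) {suc ∘ suc} (λ _ → ≤-refl))

range-reindex : ∀ a e → let t = 3 + a ; n = t + e in
  sumℚ (map (λ i → frac (n ∸ i) ((i ∸ 2) * (i ∸ 1))) (range t n))
    ≡ ∑ℚ[ j < e ] frac (e ∸ j) ((suc a + j) * (suc (suc a) + j))
range-reindex a e = begin
    sumℚ (map g (map (t +_) (upTo (n ∸ t))))
  ≡⟨ cong sumℚ (map-∘ (upTo (n ∸ t))) ⟨
    sumℚ (map (g ∘ (t +_)) (upTo (n ∸ t)))
  ≡⟨ cong sumℚ (map-upTo (g ∘ (t +_)) (n ∸ t)) ⟩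
    ∑ℚ (n ∸ t) (g ∘ (t +_))
  ≡⟨ cong (λ k → ∑ℚ k (g ∘ (t +_))) (m+n∸m≡n a e) ⟩
    ∑ℚ e (g ∘ (t +_))
  ≡⟨ ∑ℚ-cong e (λ j _ → cong (λ x → frac x ((suc a + j) * (suc (suc a) + j))) ([m+n]∸[m+o]≡n∸o a e j)) ⟩
    ∑ℚ[ j < e ] frac (e ∸ j) ((suc a + j) * (suc (suc a) + j)) ∎
  where
  open ≡-Reasoning
  t = 3 + a
  n = t + e
  g = λ i → frac (n ∸ i) ((i ∸ 2) * (i ∸ 1))

frac-count : ∀ r A j m X → suc A * X ≡ j * m ! →
  frac (r * X) ((2 + m) !) ≡ (frac r (2 + m) *ℚ frac 1 (suc m)) *ℚ frac j (suc A)
frac-count r A j m X AX≡jm! = begin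
    frac (r * X) ((2 + m) !)
  ≡⟨ frac-cross (r * X) ((2 + m) !) (r * 1 * j) ((2 + m) * suc m * suc A) {{(2 + m) !≢0}} cross ⟩
    frac (r * 1 * j) ((2 + m) * suc m * suc A)
  ≡⟨ trans (cong (_*ℚ frac j (suc A)) (frac-* r (2 + m) 1 (suc m))) (frac-* (r * 1) ((2 + m) * suc m) j (suc A)) ⟨
    (frac r (2 + m) *ℚ frac 1 (suc m)) *ℚ frac j (suc A) ∎
  where
  open ≡-Reasoning
  cross : r * X * ((2 + m) * suc m * suc A) ≡ r * 1 * j * ((2 + m) * (suc m * m !))
  cross = begin
      r * X * ((2 + m) * suc m * suc A)      ≡⟨ regroupˡ r X (2 + m) (suc m) A ⟩
      r * (2 + m) * suc m * (suc A * X)      ≡⟨ cong (r * (2 + m) * suc m *_) AX≡jm! ⟩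
      r * (2 + m) * suc m * (j * m !)        ≡⟨ regroupʳ r (2 + m) (suc m) j (m !) ⟩
      r * 1 * j * ((2 + m) * (suc m * m !))  ∎
    where
    regroupˡ : ∀ r X n s A → r * X * (n * s * suc A) ≡ r * n * s * (suc A * X)
    regroupˡ = solve-∀
    regroupʳ : ∀ r n s j F → r * n * s * (j * F) ≡ r * 1 * j * (n * (s * F))
    regroupʳ = solve-∀

frac-1/b*a : ∀ a b → frac 1 (suc b) *ℚ frac a 1 ≡ frac a (suc b)
frac-1/b*a a b = trans (frac-* 1 (suc b) a 1) (frac-cross (1 * a) (suc b * 1) a (suc b) (swap a b))
  where
  swap : ∀ a b → 1 * a * suc b ≡ a * (suc b * 1)
  swap = solve-∀

probPerm≡δ : ∀ a e → 1 ≤ e → let t = 3 + a ; n = t + e in probPerm n (inP₁∖P₁′ n t) ≡ δ n t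
probPerm≡δ a e 1≤e = begin
    frac (length (filterᵇ (inP₁∖P₁′ n t) (permutations n))) (n !)
  ≡⟨ cong (λ x → frac x (n !)) (trans (#permutations≡#arr n (inP₁∖P₁′ n t)) (#arr-event m a (2+a≤m))) ⟩
    frac (∑[ j < n ∸ r ] (r * X j)) (n !)
  ≡⟨ cong (λ k → frac (∑[ j < k ] (r * X j)) (n !)) (trans (+-∸-assoc 1 (m≤m+n a e)) (cong suc (m+n∸m≡n a e))) ⟩
    frac (∑[ j < suc e ] (r * X j)) (n !)
  ≡⟨ frac-∑ (suc e) (λ j → r * X j) (n !) ⟩
    ∑ℚ[ j < suc e ] frac (r * X j) (n !)
  ≡⟨ ∑ℚ-cong (suc e) (λ j j≤e → frac-count r (a + j) j m (X j)
                                     (#arr-beatsPrefix-items m a j (+-monoʳ-≤ (suc a) (≤-pred j≤e)))) ⟩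
    ∑ℚ[ j < suc e ] (c *ℚ frac j (suc a + j))
  ≡⟨ ∑ℚ-*ˡ (suc e) c (λ j → frac j (suc a + j)) ⟩
    c *ℚ ∑ℚ[ j < suc e ] frac j (suc a + j)
  ≡⟨ cong (c *ℚ_) (∑j/[A+j]≡A∑[e∸j]/[A+j][A+j+1] a e) ⟩
    c *ℚ (frac (suc a) 1 *ℚ R)
  ≡⟨ regroup (frac r n) (frac 1 (suc m)) (frac (suc a) 1) R ⟩
    (frac r n *ℚ (frac 1 (suc m) *ℚ frac (suc a) 1)) *ℚ R
  ≡⟨ cong (λ x → (frac r n *ℚ x) *ℚ R) (frac-1/b*a (suc a) m) ⟩
    (frac r n *ℚ frac (suc a) (suc m)) *ℚ R
  ≡⟨ cong ((frac r n *ℚ frac (suc a) (suc m)) *ℚ_) (range-reindex a e) ⟨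
    δ n t ∎
  where
  open ≡-Reasoning
  t = 3 + a
  n = t + e
  r = 2 + a
  m = suc a + e
  X : ℕ → ℕ
  X j = #arr m (applyUpTo (suc ∘ suc) m) (beatsPrefix (suc a) j)
  R = ∑ℚ[ j < e ] frac (e ∸ j) ((suc a + j) * (suc (suc a) + j))
  c = frac r n *ℚ frac 1 (suc m)
  2+a≤m : 2 + a ≤ m
  2+a≤m = subst (_≤ m) (+-comm (suc a) 1) (+-monoʳ-≤ (suc a) 1≤e)
  regroup : ∀ x y z w → (x *ℚ y) *ℚ (z *ℚ w) ≡ (x *ℚ (y *ℚ z)) *ℚ w
  regroup x y z w = trans (sym (ℚ.*-assoc (x *ℚ y) z w)) (cong (_*ℚ w) (ℚ.*-assoc x y z))

lemma14 : (n t : ℕ) → 2 < t → t ≤ n ∸ 2 →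
    probPerm n (λ π → inP₁ n t π ∧ not (inP₁' n t π))
      ≡ (frac (t ∸ 1) n *ℚ frac (t ∸ 2) (n ∸ 1))
          *ℚ sumℚ (map (λ i → frac (n ∸ i) ((i ∸ 2) * (i ∸ 1))) (range t n))
lemma14 n (suc zero)       (s≤s ()) _
lemma14 n (suc (suc zero)) (s≤s (s≤s ())) _
lemma14 (suc (suc m)) t@(suc (suc (suc a))) _ t≤m =
  subst (λ n → probPerm n (inP₁∖P₁′ n t) ≡ δ n t) (m+[n∸m]≡n (<⇒≤ t<n)) (probPerm≡δ a (n ∸ t) (m<n⇒0<n∸m t<n))
  where
  n = suc (suc m)
  t<n : t < n
  t<n = s≤s (m≤n⇒m≤1+n t≤m)
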